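{- Let an instance of the two-stage problem $\mathcal{P}$-Poly be given (clients $\mathcal{C}$, facilities $\mathcal{F}$, stage-I family $\mathcal{M}_I$, scenarios $A\in Q$ with probabilities $p_A$, stage-I costs $c^I$, stage-II costs $c^A$, budget $B$, radii $R_j$). For each $A\in Q$ let $(H_A,\pi^A)=\mathrm{GreedyCluster}(A,R,-R)$, and let $i^A_j=\arg\min_{i\in G_j}c^A_i$. Define the RW-Sup instance $\mathfrak{I}'$ on $\mathcal{C},\mathcal{F}$ with radii $R_j$, $\mathcal{M}=\mathcal{M}_I$, $V=B$, facility weights $w_i=c^I_i$ and client weights $v_j=\sum_{A\in Q:\,j\in H_A}p_A\,c^A_{i^A_j}$. If the original instance is feasible, then $\mathfrak{I}'$ is feasible, i.e. there is $S\in\mathcal{M}_I$ with $\sum_{i\in S}w_i+\sum_{j\in\mathcal{C}:d(j,S)>R_j}v_j\le V$.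
   Context: Clients and facilities lie in a metric space with distance $d$, $d(j,S)=\min_{i\in S}d(i,j)$; $G_j=\{i\in\mathcal{F}:d(i,j)\le R_j\}$, and $d(j,\mathcal{F})\le R_j$ for all $j$. A strategy consists of $F_I\in\mathcal{M}_I$ and $F_A\subseteq\mathcal{F}$ for each $A\in Q$; the instance is feasible if some strategy satisfies $\sum_{i\in F_I}c^I_i+\sum_{A\in Q}p_A\sum_{i\in F_A}c^A_i\le B$ and $d(j,F_I\cup F_A)\le R_j$ for all $A\in Q$, $j\in A$. $\mathrm{GreedyCluster}(\mathcal{Q},R,g)$: start with $H=\emptyset$; go through the clients $j$ of $\mathcal{Q}$ in decreasing order of $g(j)$ (ties by index), skipping those already removed; for each such $j$, add $j$ to $H$ and, for every $j'$ still in $\mathcal{Q}$ with $G_j\cap G_{j'}\ne\emptyset$ (including $j$ itself), set $\pi(j')=j$ and remove $j'$ from $\mathcal{Q}$; output $(H,\pi)$. With $g=-R$ clients are processed in increasing order of radius.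
   Formalization: The distance $d$, the radii $R_j$, the probabilities $p_A$, the costs $c^I$ and $c^A$, and the budget $B$ all take values in ℚ. -}

module Defs where

open import Data.Nat as ℕ using (ℕ; zero; suc)
open import Data.Fin using (Fin)
open import Data.Fin.Properties using (any?)
open import Data.Fin.Subset using (Subset; _∈_)
open import Data.Fin.Subset.Properties using (_∈?_)
open import Data.List using (List; []; _∷_; filter; length; foldr; map)
open import Data.List.Relation.Unary.Any using (Any)
open import Data.Vec using (allFin)
open import Data.Vec as Vec using ()
open import Data.Rational using (ℚ; 0ℚ; _+_; _*_; _≤_; _<_; _≤?_; _<?_)
open import Data.Product using (Σ; ∃; _×_; _,_)
open import Data.Sum using (_⊎_; inj₁; inj₂)
open import Data.Maybe using (Maybe; just; nothing; maybe)
open import Relation.Nullary using (Dec; yes; no; ¬_; does)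
open import Relation.Nullary.Decidable using (_×-dec_; ¬?)
open import Data.Bool using (if_then_else_)
open import Relation.Binary.PropositionalEquality using (_≡_)
open import Data.Fin using (_≟_)
import Data.List.Relation.Unary.Any as Any

finList : (n : ℕ) → List (Fin n)
finList n = Vec.toList (allFin n)

sumL : {A : Set} → List A → (A → ℚ) → ℚ
sumL xs f = foldr (λ x acc → f x + acc) 0ℚ xs

sumSub : {n : ℕ} → Subset n → (Fin n → ℚ) → ℚ
sumSub {n} S f = sumL (filter (λ x → x ∈? S) (finList n)) f

-- Points of the metric space: clients (inj₁) and facilities (inj₂)
Pt : ℕ → ℕ → Set
Pt nC nF = Fin nC ⊎ Fin nF

record IsMetric {X : Set} (d : X → X → ℚ) : Set where
  field
    nonneg : ∀ x y → 0ℚ ≤ d x y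
    refl0  : ∀ x → d x x ≡ 0ℚ
    symm   : ∀ x y → d x y ≡ d y x
    triang : ∀ x y z → d x z ≤ d x y + d y z

module _ {nC nF : ℕ} (d : Pt nC nF → Pt nC nF → ℚ) (R : Fin nC → ℚ) where

  dist : Fin nF → Fin nC → ℚ
  dist i j = d (inj₂ i) (inj₁ j)

  -- i ∈ G_j  iff  d(i,j) ≤ R_j
  InG : Fin nF → Fin nC → Set
  InG i j = dist i j ≤ R j

  InG? : ∀ i j → Dec (InG i j)
  InG? i j = dist i j ≤? R j

  Meets : Fin nC → Fin nC → Set
  Meets j j' = ∃ λ i → InG i j × InG i j'

  Meets? : ∀ j j' → Dec (Meets j j')
  Meets? j j' = any? (λ i → InG? i j ×-dec InG? i j')

  pickMinR : Fin nC → List (Fin nC) → Fin nC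
  pickMinR x [] = x
  pickMinR x (y ∷ ys) = if does (R y <? R x) then pickMinR y ys else pickMinR x ys

  -- greedy clustering with g = -R; fuel bounds the number of rounds
  greedyAux : ℕ → List (Fin nC) → List (Fin nC)
  greedyAux zero _ = []
  greedyAux (suc k) [] = []
  greedyAux (suc k) (x ∷ xs) =
    let j = pickMinR x xs in
    j ∷ greedyAux k (filter (λ j' → ¬? (Meets? j j')) (x ∷ xs))

  GreedyClusterH : Subset nC → List (Fin nC)
  GreedyClusterH A = greedyAux (length cs) cs
    where cs = filter (λ j → j ∈? A) (finList nC)

  argminAux : (Fin nF → ℚ) → Fin nF → List (Fin nF) → Fin nF
  argminAux c x [] = x
  argminAux c x (y ∷ ys) = if does (c y <? c x) then argminAux c y ys else argminAux c x ys

  argminG : (Fin nF → ℚ) → Fin nC → Maybe (Fin nF)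
  argminG c j with filter (λ i → InG? i j) (finList nF)
  ... | [] = nothing
  ... | x ∷ xs = just (argminAux c x xs)

  -- c_{i_j}, with i_j = argmin_{i ∈ G_j} c_i (G_j ≠ ∅ under the standing assumption)
  minCostG : (Fin nF → ℚ) → Fin nC → ℚ
  minCostG c j = maybe c 0ℚ (argminG c j)

  -- d(j, S) ≤ R_j  (S ⊆ F finite; min over S attains)
  CoveredBy : Subset nF → Fin nC → Set
  CoveredBy S j = ∃ λ i → i ∈ S × InG i j

  CoveredBy? : ∀ S j → Dec (CoveredBy S j)
  CoveredBy? S j = any? (λ i → (i ∈? S) ×-dec InG? i j)

  clientWeight : {m : ℕ} → (Fin m → Subset nC) → (Fin m → ℚ) → (Fin m → Fin nF → ℚ)
               → Fin nC → ℚ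
  clientWeight {m} A p cA j =
    sumL (finList m) (λ a →
      if does (Any.any? (λ x → j ≟ x) (GreedyClusterH (A a)))
      then p a * minCostG (cA a) j else 0ℚ)

  rwCost : Subset nF → (Fin nF → ℚ) → (Fin nC → ℚ) → ℚ
  rwCost S w v = sumSub S w + sumL (finList nC) (λ j → if does (CoveredBy? S j) then 0ℚ else v j)

  TwoStageFeasible : {m : ℕ} → (Subset nF → Set) → (Fin m → Subset nC) → (Fin m → ℚ)
                   → (Fin nF → ℚ) → (Fin m → Fin nF → ℚ) → ℚ → Set
  TwoStageFeasible {m} MI A p cI cA B =
    Σ (Subset nF) λ FI → Σ (Fin m → Subset nF) λ FA →
      MI FI
      × (sumSub FI cI + sumL (finList m) (λ a → p a * sumSub (FA a) (cA a)) ≤ B)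
      × (∀ a j → j ∈ A a → ∃ λ i → (i ∈ FI ⊎ i ∈ FA a) × InG i j)

  RWSupFeasible : (Subset nF → Set) → ℚ → (Fin nF → ℚ) → (Fin nC → ℚ) → Set
  RWSupFeasible M V w v = Σ (Subset nF) λ S → M S × (rwCost S w v ≤ V)

module Submission where

-- Take S = F_I, the stage-I set of a feasible two-stage
-- strategy (F_I, (F_A)_A).  Then S ∈ M_I, and it remains to bound the
-- weight of the clients left uncovered by F_I by the expected stage-II cost:
--   Σ_{j uncovered} v_j  =  Σ_A p_A Σ_{j ∈ H_A uncovered} c^A(i^A_j)
--                        ≤  Σ_A p_A Σ_{i ∈ F_A} c^A_i.
-- For a fixed scenario A every uncovered j ∈ H_A is served by some i ∈ F_A
-- with i ∈ G_j, and c^A(i^A_j) ≤ c^A_i since i^A_j minimises c^A over G_j.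
-- The balls G_j of distinct cluster centres j ∈ H_A are disjoint, so every
-- facility is charged by at most one centre.  This is an instance of a
-- general double-counting "charging lemma" for finite sums.

open import Defs
open import Data.Nat using (ℕ)
open import Data.Fin using (Fin)
open import Data.Fin.Subset using (Subset)
open import Data.Rational using (ℚ; 0ℚ; 1ℚ; _≤_)
open import Data.Product using (∃)
open import Relation.Binary.PropositionalEquality using (_≡_)

open import Algebra.Bundles using (CommutativeMonoid)
open import Data.Bool using (true; false; if_then_else_)
open import Data.Fin using (_≟_) renaming (zero to fzero; suc to fsuc)
open import Data.Nat using (zero; suc)
open import Data.Fin.Subset using () renaming (_∈_ to _∈ₛ_)
open import Data.Fin.Subset.Properties using (_∈?_)
open import Data.List using (List; []; _∷_; filter)
import Data.List as List
open import Data.List.Membership.Propositional using (_∈_)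
open import Data.List.Membership.Propositional.Properties using (∈-filter⁺; ∈-filter⁻)
open import Data.List.Relation.Unary.All using (All; []; _∷_)
import Data.List.Relation.Unary.All as All
open import Data.List.Relation.Unary.Any using (here; there)
import Data.List.Relation.Unary.Any as Any
open import Data.List.Relation.Unary.Unique.Propositional using (Unique; []; _∷_)
open import Data.List.Relation.Unary.Unique.Propositional.Properties using (allFin⁺)
open import Data.Product using (_×_; _,_; proj₁; proj₂)
open import Data.Rational using (_+_; _*_; _<_; _<?_; nonNegative)
open import Data.Rational.Properties
  using (≤-refl; ≤-reflexive; ≤-trans; <⇒≤; ≮⇒≥; +-mono-≤; +-identityˡ; +-identityʳ;
         *-zeroʳ; *-distribˡ-+; *-monoˡ-≤-nonNeg; +-0-commutativeMonoid)
open import Algebra.Properties.CommutativeSemigroup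
  (CommutativeMonoid.commutativeSemigroup +-0-commutativeMonoid) using (interchange)
open import Data.Sum using (_⊎_; inj₁; inj₂)
import Data.Vec as Vec
open import Data.Vec.Membership.Propositional.Properties using (∈-allFin⁺; ∈-toList⁺)
open import Relation.Binary.PropositionalEquality using (refl; sym; trans; cong; cong₂; subst)
open import Relation.Nullary using (Dec; yes; no; ¬_; does; contradiction)
open import Relation.Nullary.Decidable using (_×-dec_; ¬?)
open import Relation.Unary using (Pred; Decidable)

-- The enumeration finList n of Fin n is complete and duplicate-free; this is
-- what makes sums over finList genuine sums over the finite set.

finList-complete : ∀ {n} (i : Fin n) → i ∈ finList n
finList-complete i = ∈-toList⁺ (∈-allFin⁺ i)

-- finList is the list-library enumeration allFin, whose uniqueness is known.
toList-tabulate : ∀ {A : Set} {n} (f : Fin n → A) → Vec.toList (Vec.tabulate f) ≡ List.tabulate f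
toList-tabulate {n = zero} f = refl
toList-tabulate {n = suc n} f = cong (f fzero ∷_) (toList-tabulate (λ k → f (fsuc k)))

finList-unique : ∀ n → Unique (finList n)
finList-unique n = subst Unique (sym (toList-tabulate (λ k → k))) (allFin⁺ n)

indicator : {P : Set} → Dec P → ℚ → ℚ
indicator P? x = if does P? then x else 0ℚ

indicator-yes : ∀ {P : Set} (P? : Dec P) {x} → P → indicator P? x ≡ x
indicator-yes (yes _) _ = refl
indicator-yes (no ¬p) p = contradiction p ¬p

indicator-no : ∀ {P : Set} (P? : Dec P) {x} → ¬ P → indicator P? x ≡ 0ℚ
indicator-no (yes p) ¬p = contradiction p ¬p
indicator-no (no _) _ = refl

indicator-nonneg : ∀ {P : Set} (P? : Dec P) {x} → 0ℚ ≤ x → 0ℚ ≤ indicator P? x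
indicator-nonneg (yes _) 0≤x = 0≤x
indicator-nonneg (no _) _ = ≤-refl

indicator-*ˡ : ∀ {P : Set} (P? : Dec P) c x → c * indicator P? x ≡ indicator P? (c * x)
indicator-*ˡ (yes _) c x = refl
indicator-*ˡ (no _) c x = *-zeroʳ c

module _ {X : Set} where

  sumL-cong : ∀ xs {f g : X → ℚ} → (∀ x → f x ≡ g x) → sumL xs f ≡ sumL xs g
  sumL-cong [] f≡g = refl
  sumL-cong (x ∷ xs) f≡g = cong₂ _+_ (f≡g x) (sumL-cong xs f≡g)

  sumL-mono : ∀ xs {f g : X → ℚ} → (∀ x → f x ≤ g x) → sumL xs f ≤ sumL xs g
  sumL-mono [] f≤g = ≤-refl
  sumL-mono (x ∷ xs) f≤g = +-mono-≤ (f≤g x) (sumL-mono xs f≤g)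

  sumL-zeros : ∀ {xs} (f : X → ℚ) → All (λ x → f x ≡ 0ℚ) xs → sumL xs f ≡ 0ℚ
  sumL-zeros f [] = refl
  sumL-zeros {x ∷ xs} f (fx≡0 ∷ rest) =
    trans (cong₂ _+_ fx≡0 (sumL-zeros f rest)) (+-identityˡ 0ℚ)

  sumL-nonneg : ∀ xs {f : X → ℚ} → (∀ x → 0ℚ ≤ f x) → 0ℚ ≤ sumL xs f
  sumL-nonneg [] _ = ≤-refl
  sumL-nonneg (x ∷ xs) {f} 0≤f =
    subst (_≤ f x + sumL xs f) (+-identityˡ 0ℚ) (+-mono-≤ (0≤f x) (sumL-nonneg xs 0≤f))

  sumL-+ : ∀ xs (f g : X → ℚ) → sumL xs (λ x → f x + g x) ≡ sumL xs f + sumL xs g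
  sumL-+ [] f g = sym (+-identityˡ 0ℚ)
  sumL-+ (x ∷ xs) f g =
    trans (cong ((f x + g x) +_) (sumL-+ xs f g)) (interchange (f x) (g x) _ _)

  sumL-*ˡ : ∀ xs c (f : X → ℚ) → sumL xs (λ x → c * f x) ≡ c * sumL xs f
  sumL-*ˡ [] c f = sym (*-zeroʳ c)
  sumL-*ˡ (x ∷ xs) c f =
    trans (cong ((c * f x) +_) (sumL-*ˡ xs c f)) (sym (*-distribˡ-+ c (f x) _))

  term≤sumL : ∀ {xs x} (f : X → ℚ) → (∀ y → 0ℚ ≤ f y) → x ∈ xs → f x ≤ sumL xs f
  term≤sumL {x ∷ xs} f 0≤f (here refl) =
    subst (_≤ f x + sumL xs f) (+-identityʳ (f x)) (+-mono-≤ (≤-refl {f x}) (sumL-nonneg xs 0≤f))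
  term≤sumL {y ∷ xs} {x} f 0≤f (there x∈xs) =
    subst (_≤ f y + sumL xs f) (+-identityˡ (f x)) (+-mono-≤ (0≤f y) (term≤sumL f 0≤f x∈xs))

sumL-swap : ∀ {X Y : Set} xs ys (g : X → Y → ℚ)
          → sumL xs (λ x → sumL ys (g x)) ≡ sumL ys (λ y → sumL xs (λ x → g x y))
sumL-swap [] ys g = sym (sumL-zeros _ (All.universal (λ _ → refl) ys))
sumL-swap (x ∷ xs) ys g =
  trans (cong (sumL ys (g x) +_) (sumL-swap xs ys g)) (sym (sumL-+ ys (g x) _))

indicatorSum≤ : ∀ {X : Set} {P : Pred X _} (P? : Decidable P) {c : ℚ} → 0ℚ ≤ c
              → (∀ {x x'} → P x → P x' → x ≡ x')
              → ∀ {xs} → Unique xs → sumL xs (λ x → indicator (P? x) c) ≤ c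
indicatorSum≤ P? 0≤c atMostOne [] = 0≤c
indicatorSum≤ P? {c} 0≤c atMostOne {x ∷ xs} (x∉xs ∷ unique) with P? x
... | yes px = ≤-reflexive (trans (cong (c +_) othersVanish) (+-identityʳ c))
  where
  othersVanish : sumL xs (λ y → indicator (P? y) c) ≡ 0ℚ
  othersVanish = sumL-zeros _ (All.map (λ x≢y → indicator-no (P? _) (λ py → x≢y (atMostOne px py))) x∉xs)
... | no _ = subst (_≤ c) (sym (+-identityˡ _)) (indicatorSum≤ P? 0≤c atMostOne unique)

charging : ∀ {X Y : Set} (Ch : X → Y → Set) (Ch? : ∀ x y → Dec (Ch x y))
         → (∀ {x x' y} → Ch x y → Ch x' y → x ≡ x')
         → ∀ {xs} → Unique xs → (ys : List Y) (f : X → ℚ) (c : Y → ℚ) → (∀ y → 0ℚ ≤ c y)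
         → (∀ x → f x ≤ 0ℚ ⊎ ∃ λ y → y ∈ ys × Ch x y × f x ≤ c y)
         → sumL xs f ≤ sumL ys c
charging {X} {Y} Ch Ch? chargedOnce {xs} unique ys f c 0≤c charges =
  ≤-trans (sumL-mono xs fBound)
    (subst (_≤ sumL ys c) (sym (sumL-swap xs ys charge))
      (sumL-mono ys (λ y → indicatorSum≤ (λ x → Ch? x y) (0≤c y) chargedOnce unique)))
  where
  charge : X → Y → ℚ
  charge x y = indicator (Ch? x y) (c y)

  0≤charge : ∀ x y → 0ℚ ≤ charge x y
  0≤charge x y = indicator-nonneg (Ch? x y) (0≤c y)

  fBound : ∀ x → f x ≤ sumL ys (charge x)
  fBound x with charges x
  ... | inj₁ fx≤0 = ≤-trans fx≤0 (sumL-nonneg ys (0≤charge x))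
  ... | inj₂ (y , y∈ys , ch , fx≤cy) =
    ≤-trans fx≤cy (subst (_≤ _) (indicator-yes (Ch? x y) ch) (term≤sumL (charge x) (0≤charge x) y∈ys))

module Clustering {nC nF : ℕ} (d : Pt nC nF → Pt nC nF → ℚ) (R : Fin nC → ℚ) where

  pickMinR-∈ : ∀ x xs → pickMinR d R x xs ∈ x ∷ xs
  pickMinR-∈ x [] = here refl
  pickMinR-∈ x (y ∷ ys) with does (R y <? R x)
  ... | true = there (pickMinR-∈ y ys)
  ... | false with pickMinR-∈ x ys
  ...   | here eq = here eq
  ...   | there p = there (there p)

  greedyAux-⊆ : ∀ k xs {j} → j ∈ greedyAux d R k xs → j ∈ xs
  greedyAux-⊆ (suc k) (x ∷ xs) (here refl) = pickMinR-∈ x xs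
  greedyAux-⊆ (suc k) (x ∷ xs) (there p) =
    proj₁ (∈-filter⁻ (λ j' → ¬? (Meets? d R (pickMinR d R x xs) j')) (greedyAux-⊆ k _ p))

  -- Each new centre removes all clients whose ball meets its own, so the balls
  -- of two centres that meet belong to the same centre.
  greedyAux-separated : ∀ k xs {j j'} → j ∈ greedyAux d R k xs → j' ∈ greedyAux d R k xs
                      → Meets d R j j' → j ≡ j'
  greedyAux-separated (suc k) (x ∷ xs) (here refl) (here refl) _ = refl
  greedyAux-separated (suc k) (x ∷ xs) (here refl) (there p') meet =
    contradiction meet (proj₂ (∈-filter⁻ (λ j' → ¬? (Meets? d R _ j')) (greedyAux-⊆ k _ p')))
  greedyAux-separated (suc k) (x ∷ xs) (there p) (here refl) (i , g , g') =
    contradiction (i , g' , g) (proj₂ (∈-filter⁻ (λ j' → ¬? (Meets? d R _ j')) (greedyAux-⊆ k _ p)))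
  greedyAux-separated (suc k) (x ∷ xs) (there p) (there p') meet =
    greedyAux-separated k _ p p' meet

  H-⊆ : ∀ A {j} → j ∈ GreedyClusterH d R A → j ∈ₛ A
  H-⊆ A j∈H = proj₂ (∈-filter⁻ (λ j → j ∈? A) {xs = finList nC} (greedyAux-⊆ _ _ j∈H))

  H-separated : ∀ A {j j'} → j ∈ GreedyClusterH d R A → j' ∈ GreedyClusterH d R A
              → Meets d R j j' → j ≡ j'
  H-separated A = greedyAux-separated _ _

  argminAux-minimal : ∀ (c : Fin nF → ℚ) x xs {y} → y ∈ x ∷ xs → c (argminAux d R c x xs) ≤ c y
  argminAux-minimal c x [] (here refl) = ≤-refl
  argminAux-minimal c x (z ∷ zs) {y} = step (c z <? c x)
    where
    step : (z<x? : Dec (c z < c x)) → y ∈ x ∷ z ∷ zs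
         → c (if does z<x? then argminAux d R c z zs else argminAux d R c x zs) ≤ c y
    step (yes z<x) (here refl) = ≤-trans (argminAux-minimal c z zs (here refl)) (<⇒≤ z<x)
    step (yes _) (there y∈) = argminAux-minimal c z zs y∈
    step (no _) (here refl) = argminAux-minimal c x zs (here refl)
    step (no z≮x) (there (here refl)) = ≤-trans (argminAux-minimal c x zs (here refl)) (≮⇒≥ z≮x)
    step (no _) (there (there y∈)) = argminAux-minimal c x zs (there y∈)

  minCostG-≤ : ∀ (c : Fin nF → ℚ) j i → InG d R i j → minCostG d R c j ≤ c i
  minCostG-≤ c j i i∈G
    with filter (λ i → InG? d R i j) (finList nF) | ∈-filter⁺ (λ i → InG? d R i j) (finList-complete i) i∈G
  ... | x ∷ xs | i∈ = argminAux-minimal c x xs i∈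

module StageTwo {nC nF m : ℕ} (d : Pt nC nF → Pt nC nF → ℚ) (R : Fin nC → ℚ)
  (A : Fin m → Subset nC) (p : Fin m → ℚ) (cA : Fin m → Fin nF → ℚ)
  (FI : Subset nF) (FA : Fin m → Subset nF)
  (cover : ∀ a j → j ∈ₛ A a → ∃ λ i → (i ∈ₛ FI ⊎ i ∈ₛ FA a) × InG d R i j) where
  open Clustering d R

  H : Fin m → List (Fin nC)
  H a = GreedyClusterH d R (A a)

  Charged : Fin m → Fin nC → Set
  Charged a j = ¬ CoveredBy d R FI j × j ∈ H a

  charged? : ∀ a j → Dec (Charged a j)
  charged? a j = ¬? (CoveredBy? d R FI j) ×-dec Any.any? (j ≟_) (H a)

  chargedCost : Fin m → Fin nC → ℚ
  chargedCost a j = indicator (charged? a j) (minCostG d R (cA a) j)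

  uncoveredWeight : ∀ j → (if does (CoveredBy? d R FI j) then 0ℚ else clientWeight d R A p cA j)
                        ≡ sumL (finList m) (λ a → p a * chargedCost a j)
  uncoveredWeight j with CoveredBy? d R FI j
  ... | yes _ = sym (sumL-zeros _ (All.universal (λ a → *-zeroʳ (p a)) (finList m)))
  ... | no _ = sumL-cong (finList m) (λ a →
                 sym (indicator-*ˡ (Any.any? (j ≟_) (H a)) (p a) (minCostG d R (cA a) j)))

  -- In scenario a the paying clients are charged to distinct facilities of FA a.
  scenarioBound : ∀ a → (∀ i → 0ℚ ≤ cA a i) → sumL (finList nC) (chargedCost a) ≤ sumSub (FA a) (cA a)
  scenarioBound a 0≤cA =
    charging (λ j i → j ∈ H a × InG d R i j)
             (λ j i → Any.any? (j ≟_) (H a) ×-dec InG? d R i j)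
             (λ (j∈H , g) (j'∈H , g') → H-separated (A a) j∈H j'∈H (_ , g , g'))
             (finList-unique nC) _ (chargedCost a) (cA a) 0≤cA chargeOf
    where
    chargeOf : ∀ j → chargedCost a j ≤ 0ℚ
                   ⊎ ∃ λ i → i ∈ filter (_∈? FA a) (finList nF) × (j ∈ H a × InG d R i j)
                             × chargedCost a j ≤ cA a i
    chargeOf j = byCase (charged? a j)
      where
      byCase : (ch? : Dec (Charged a j)) → indicator ch? (minCostG d R (cA a) j) ≤ 0ℚ
             ⊎ ∃ λ i → i ∈ filter (_∈? FA a) (finList nF) × (j ∈ H a × InG d R i j)
                       × indicator ch? (minCostG d R (cA a) j) ≤ cA a i
      byCase (no _) = inj₁ ≤-refl
      byCase (yes (uncovered , j∈H)) with cover a j (H-⊆ (A a) j∈H)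
      ... | i , inj₁ i∈FI , g = contradiction (i , i∈FI , g) uncovered
      ... | i , inj₂ i∈FA , g =
        inj₂ (i , ∈-filter⁺ (_∈? FA a) (finList-complete i) i∈FA , (j∈H , g) , minCostG-≤ (cA a) j i g)

  uncoveredWeight≤ : (∀ a → 0ℚ ≤ p a) → (∀ a i → 0ℚ ≤ cA a i)
    → sumL (finList nC) (λ j → if does (CoveredBy? d R FI j) then 0ℚ else clientWeight d R A p cA j)
      ≤ sumL (finList m) (λ a → p a * sumSub (FA a) (cA a))
  uncoveredWeight≤ 0≤p 0≤cA = subst (_≤ _) (sym regroup)
    (sumL-mono (finList m) (λ a → *-monoˡ-≤-nonNeg (p a) {{nonNegative (0≤p a)}} (scenarioBound a (0≤cA a))))
    where
    regroup : sumL (finList nC) (λ j → if does (CoveredBy? d R FI j) then 0ℚ else clientWeight d R A p cA j)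
            ≡ sumL (finList m) (λ a → p a * sumL (finList nC) (chargedCost a))
    regroup = trans (sumL-cong (finList nC) uncoveredWeight)
             (trans (sumL-swap (finList nC) (finList m) (λ j a → p a * chargedCost a j))
                    (sumL-cong (finList m) (λ a → sumL-*ˡ (finList nC) (p a) (chargedCost a))))

lemma2 : (nC nF m : ℕ)
    → (d : Pt nC nF → Pt nC nF → ℚ) → IsMetric d
    → (R : Fin nC → ℚ)
    → (∀ j → ∃ λ i → InG d R i j)
    → (MI : Subset nF → Set)
    → (A : Fin m → Subset nC) → (p : Fin m → ℚ)
    → (∀ a → 0ℚ ≤ p a) → sumL (finList m) p ≡ 1ℚ
    → (cI : Fin nF → ℚ) → (∀ i → 0ℚ ≤ cI i)
    → (cA : Fin m → Fin nF → ℚ) → (∀ a i → 0ℚ ≤ cA a i)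
    → (B : ℚ)
    → TwoStageFeasible d R MI A p cI cA B
    → RWSupFeasible d R MI B cI (clientWeight d R A p cA)
lemma2 nC nF m d _ R _ MI A p 0≤p _ cI _ cA 0≤cA B (FI , FA , FI∈MI , withinBudget , cover) =
  FI , FI∈MI , ≤-trans (+-mono-≤ (≤-refl {sumSub FI cI}) stageTwo) withinBudget
  where
  stageTwo : sumL (finList nC) (λ j → if does (CoveredBy? d R FI j) then 0ℚ else clientWeight d R A p cA j)
             ≤ sumL (finList m) (λ a → p a * sumSub (FA a) (cA a))
  stageTwo = StageTwo.uncoveredWeight≤ d R A p cA FI FA cover 0≤p 0≤cA
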